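{- Let $T$ be a decomposition tree and $v$ an internal node of $T$ labeled $\otimes$, with left child $v_l$ and right child $v_r$, and assume that both $v_l$ and $v_r$ have the staircase property. Then $\hat\alpha(v)=\hat\alpha(v_l)-\hat\beta(v_r)$ if $\hat\alpha(v_l)>\hat\beta(v_r)$; $\hat\alpha(v)=\hat\alpha(v_r)-\hat\beta(v_l)$ if $\hat\alpha(v_r)>\hat\beta(v_l)$; and $\hat\alpha(v)=|\hat\alpha(v_l)-\hat\alpha(v_r)|\bmod 2$ otherwise.
   Context: All graphs are finite, simple and undirected. For a graph $H$ and $S\subseteq V(H)$, $N_H[S]$ is the closed neighbourhood of $S$ in $H$ and $H[S]$ the induced subgraph; a graph with no vertices is regarded as having a (empty) perfect matching. A decomposition tree is a rooted tree $T$ in which every internal node has exactly two children, a left child $v_l$ and a right child $v_r$, and carries one of the labels $\otimes$ (true twin), $\odot$ (false twin), $\oplus$ (attachment). To each node $v$ are associated a graph $\hat G(v)$ and a twin set $\hat{TS}(v)\subseteq V(\hat G(v))$: for a leaf, $\hat G(v)$ is a single vertex $x$ (distinct leaves giving distinct vertices) and $\hat{TS}(v)=\{x\}$; for an internal node $v$, $V(\hat G(v))=V(\hat G(v_l))\cup V(\hat G(v_r))$ and: if $v$ is labeled $\otimes$, $E(\hat G(v))=E(\hat G(v_l))\cup E(\hat G(v_r))\cup\{xy: x\in \hat{TS}(v_l), y\in\hat{TS}(v_r)\}$ and $\hat{TS}(v)=\hat{TS}(v_l)\cup\hat{TS}(v_r)$; if labeled $\odot$, $E(\hat G(v))=E(\hat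 G(v_l))\cup E(\hat G(v_r))$ and $\hat{TS}(v)=\hat{TS}(v_l)\cup\hat{TS}(v_r)$; if labeled $\oplus$, the edge set is as for $\otimes$ and $\hat{TS}(v)=\hat{TS}(v_l)$. For a node $u$ and $0\le k\le|\hat{TS}(u)|$, $\hat\gamma_k(u)$ is the minimum of $|S|$ over all $S\subseteq V(\hat G(u))$ with $V(\hat G(u))\setminus \hat{TS}(u)\subseteq N_{\hat G(u)}[S]$ for which there is $X\subseteq S\cap\hat{TS}(u)$, $|X|=k$, such that $\hat G(u)[S\setminus X]$ has a perfect matching. Let $\widehat{\min}(u)=\min\{\hat\gamma_k(u):0\le k\le|\hat{TS}(u)|\}$, and let $\hat\alpha(u)$ (resp. $\hat\beta(u)$) be the smallest (resp. largest) $k$ with $\hat\gamma_k(u)=\widehat{\min}(u)$. A node $u$ has the staircase property if for every $0\le k\le|\hat{TS}(u)|$: $\hat\gamma_k(u)=\widehat{\min}(u)+\hat\alpha(u)-k$ if $k\le\hat\alpha(u)$; $\hat\gamma_k(u)=\widehat{\min}(u)+k-\hat\beta(u)$ if $k\ge\hat\beta(u)$; $\hat\gamma_k(u)=\widehat{\min}(u)$ if $\hat\alpha(u)<k<\hat\beta(u)$ and $k-\hat\alpha(u)$ is even; and $\hat\gamma_k(u)=\widehat{\min}(u)+1$ otherwise. -}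

module Defs where

open import Data.Nat using (ℕ; zero; suc; _+_; _∸_; _≤_; _<_; _≤ᵇ_; _≡ᵇ_; ∣_-_∣)
open import Data.Nat.DivMod using (_%_)
open import Data.Bool using (Bool; true; false; if_then_else_)
open import Data.Fin using (Fin; splitAt)
open import Data.Fin.Subset using (Subset; _∈_; _∉_; _⊆_; ∣_∣; ⊤; ⊥)
open import Data.Vec using (Vec; _++_; [_])
open import Data.Product using (Σ; _×_; _,_)
open import Data.Sum using (_⊎_; inj₁; inj₂)
import Data.Empty as E
open import Relation.Binary.PropositionalEquality using (_≡_; _≢_)
open import Relation.Nullary using (¬_)

-- Node labels: ⊗ (true twin), ⊙ (false twin), ⊕ (attachment)
data Label : Set where
  ⊗ ⊙ ⊕ : Label

data Tree : Set where
  leaf : Tree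
  node : Label → Tree → Tree → Tree

-- number of vertices of Ĝ(t) (= number of leaves); vertices are Fin (size t),
-- left child's vertices first, then right child's.
size : Tree → ℕ
size leaf = 1
size (node _ l r) = size l + size r

TS : (t : Tree) → Subset (size t)
TS leaf = ⊤
TS (node ⊗ l r) = TS l ++ TS r
TS (node ⊙ l r) = TS l ++ TS r
TS (node ⊕ l r) = TS l ++ ⊥

Cross : Label → (l r : Tree) → Fin (size l) → Fin (size r) → Set
Cross ⊙ l r a b = E.⊥
Cross ⊗ l r a b = a ∈ TS l × b ∈ TS r
Cross ⊕ l r a b = a ∈ TS l × b ∈ TS r

JoinAdj : ∀ {m n} → (Fin m → Fin m → Set) → (Fin n → Fin n → Set)
        → (Fin m → Fin n → Set) → Fin m ⊎ Fin n → Fin m ⊎ Fin n → Set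
JoinAdj A B C (inj₁ a) (inj₁ b) = A a b
JoinAdj A B C (inj₂ a) (inj₂ b) = B a b
JoinAdj A B C (inj₁ a) (inj₂ b) = C a b
JoinAdj A B C (inj₂ a) (inj₁ b) = C b a

Adj : (t : Tree) → Fin (size t) → Fin (size t) → Set
Adj leaf x y = E.⊥
Adj (node lab l r) x y =
  JoinAdj (Adj l) (Adj r) (Cross lab l r) (splitAt (size l) x) (splitAt (size l) y)

DominatesNonTwins : (t : Tree) → Subset (size t) → Set
DominatesNonTwins t S =
  ∀ x → x ∉ TS t → x ∈ S ⊎ Σ (Fin (size t)) (λ y → y ∈ S × Adj t x y)

-- Ĝ(t)[W] has a perfect matching, where W = {x | x ∈ S, x ∉ X};
-- a perfect matching is given by the partner map M (an involution on W along edges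
-- without fixed points).
HasPerfectMatching : (t : Tree) → (S X : Subset (size t)) → Set
HasPerfectMatching t S X =
  Σ (Fin (size t) → Fin (size t)) λ M →
    ∀ x → x ∈ S → x ∉ X →
      (M x ∈ S) × (M x ∉ X) × (M x ≢ x) × Adj t x (M x) × (M (M x) ≡ x)

Feasible : (t : Tree) → ℕ → Subset (size t) → Set
Feasible t k S =
  DominatesNonTwins t S ×
  Σ (Subset (size t)) λ X → X ⊆ S × X ⊆ TS t × ∣ X ∣ ≡ k × HasPerfectMatching t S X

IsGamma : (t : Tree) → ℕ → ℕ → Set
IsGamma t k g =
  Σ (Subset (size t)) (λ S → Feasible t k S × ∣ S ∣ ≡ g) ×
  (∀ S → Feasible t k S → g ≤ ∣ S ∣)

IsMinGamma : (t : Tree) → ℕ → Set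
IsMinGamma t m =
  Σ ℕ (λ k → k ≤ ∣ TS t ∣ × IsGamma t k m) ×
  (∀ k g → k ≤ ∣ TS t ∣ → IsGamma t k g → m ≤ g)

IsAlpha : (t : Tree) → ℕ → Set
IsAlpha t a = Σ ℕ λ m → IsMinGamma t m × a ≤ ∣ TS t ∣ × IsGamma t a m ×
  (∀ k → k < a → ¬ IsGamma t k m)

IsBeta : (t : Tree) → ℕ → Set
IsBeta t b = Σ ℕ λ m → IsMinGamma t m × b ≤ ∣ TS t ∣ × IsGamma t b m ×
  (∀ k → b < k → k ≤ ∣ TS t ∣ → ¬ IsGamma t k m)

stair : ℕ → ℕ → ℕ → ℕ → ℕ
stair m a b k =
  if k ≤ᵇ a then m + (a ∸ k)
  else if b ≤ᵇ k then m + (k ∸ b)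
  else if ((k ∸ a) % 2) ≡ᵇ 0 then m
  else suc m

Staircase : Tree → Set
Staircase t = Σ ℕ λ m → Σ ℕ λ a → Σ ℕ λ b →
  IsMinGamma t m × IsAlpha t a × IsBeta t b ×
  (∀ k → k ≤ ∣ TS t ∣ → IsGamma t k (stair m a b k))

{-# OPTIONS --safe #-}
module Submission where

-- At a ⊗-node every vertex set is S = Sl ++ Sr and every X ⊆ S ∩ T̂S is Xl ++ Xr. An edge of a
-- perfect matching of Ĝ[S ∖ X] stays inside one child or joins a left twin to a right twin. Moving
-- the c crossing pairs into X splits the matching between the children; conversely c twins of Xl
-- can be matched with c twins of Xr. Hence S is feasible for k iff Sl, Sr are feasible for
-- kl = x + c and kr = y + c with k = x + y, so min(v) = min(l) + min(r), attained exactly at the k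
-- obtained in this way from minimisers kl, kr of the children. As |S| ≡ k (mod 2) for every feasible
-- S, the staircase property makes the minimisers of a child the progression α, α + 2, …, β, and
-- α̂(v) is the least k so obtained, which elementary arithmetic computes.

open import Defs
open import Data.Nat using (ℕ; zero; suc; _+_; _*_; _∸_; _≤_; _<_; ∣_-_∣; _≤ᵇ_; NonZero; s≤s; z≤n; s≤s⁻¹)
open import Data.Nat.Properties
  using ( +-identityʳ; +-suc; +-comm; +-cancelʳ-≡; +-cancelʳ-≤; +-monoʳ-≤; +-mono-≤; *-distribʳ-∸
        ; [m+n]∸[m+o]≡n∸o; m+[n∸m]≡n; m∸n+n≡m; m≤n⇒m∸n≡0; m≤n+o⇒m∸n≤o; m≤n⇒∣m-n∣≡n∸m; ∣-∣-comm
        ; ≤-refl; ≤-reflexive; ≤-trans; ≤-antisym; ≤-total; m≤m+n; m≤n+m; <⇒≤; <⇒≱; ≮⇒≥; module ≤-Reasoning )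
open import Data.Nat.DivMod
  using (_%_; _/_; m≡m%n+[m/n]*n; [m+n]%n≡m%n; [m+kn]%n≡m%n; %-distribˡ-+; m%n≤m; m*n%n≡0)
open import Data.Nat.Solver using (module +-*-Solver)
open import Data.Bool.Base using (true; false)
open import Data.Bool.Properties using (∨-identityʳ)
open import Data.Fin.Base using (Fin; zero; suc; _↑ˡ_; _↑ʳ_)
import Data.Fin.Base as Fin
open import Data.Fin.Properties using (_≟_; any?; suc-injective; ↑ˡ-injective; ↑ʳ-injective; splitAt-↑ˡ; splitAt-↑ʳ)
open import Data.Fin.Subset
  using (Subset; _∈_; _∉_; _⊆_; _⊂_; _⊃_; ∣_∣; ⁅_⁆; _∪_; _─_; Nonempty; inside; outside)
open import Data.Fin.Subset.Properties
  using ( _∈?_; _⊆?_; ⊆-antisym; ⊂-⊆-trans; p⊆q⇒∣p∣≤∣q∣; ∪-identityʳ; p─⊥≡p; p─q⊆p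
        ; x∈p∪q⁻; p⊆p∪q; q⊆p∪q; x∈⁅x⁆; x∈⁅y⁆⇒x≡y; x∈p∧x≢y⇒x∈p-y )
open import Data.Fin.Subset.Induction using (⊃-wellFounded; Acc; acc)
open import Data.Vec.Base using ([]; _∷_; _++_; here; there)
import Data.Vec.Base as Vec
open import Data.Product using (∃; ∃₂; _×_; _,_; proj₁; proj₂)
open import Data.Sum.Base using (_⊎_; inj₁; inj₂; [_,_]′)
import Data.Sum.Base as Sum
open import Function.Base using (_∘_; id; const)
open import Relation.Binary.PropositionalEquality
open import Relation.Nullary.Decidable using (Dec; yes; no; _×-dec_; ¬?; decidable-stable)
open import Relation.Nullary.Negation using (¬_; contradiction)
open import Relation.Unary using (Decidable)

open +-*-Solver using (solve; _:+_; _:*_; _:=_; con)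

-- Arithmetic of twin counts

m%d≡n%d⇒[m∸n]%d≡0 : ∀ m n d .{{_ : NonZero d}} → m % d ≡ n % d → (m ∸ n) % d ≡ 0
m%d≡n%d⇒[m∸n]%d≡0 m n d eq = begin
  (m ∸ n) % d
    ≡⟨ cong (_% d) (cong₂ _∸_ (m≡m%n+[m/n]*n m d) (m≡m%n+[m/n]*n n d)) ⟩
  (m % d + m / d * d ∸ (n % d + n / d * d)) % d
    ≡⟨ cong (λ r → (r + m / d * d ∸ (n % d + n / d * d)) % d) eq ⟩
  (n % d + m / d * d ∸ (n % d + n / d * d)) % d
    ≡⟨ cong (_% d) ([m+n]∸[m+o]≡n∸o (n % d) _ _) ⟩
  (m / d * d ∸ n / d * d) % d
    ≡⟨ cong (_% d) (*-distribʳ-∸ d (m / d) (n / d)) ⟨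
  ((m / d ∸ n / d) * d) % d
    ≡⟨ m*n%n≡0 (m / d ∸ n / d) d ⟩
  0 ∎
  where open ≡-Reasoning

[m+n]%2≡∣m-n∣%2 : ∀ m n → (m + n) % 2 ≡ ∣ m - n ∣ % 2
[m+n]%2≡∣m-n∣%2 zero    n       = refl
[m+n]%2≡∣m-n∣%2 (suc m) zero    = cong (_% 2) (+-identityʳ (suc m))
[m+n]%2≡∣m-n∣%2 (suc m) (suc n) = begin
  (suc m + suc n) % 2 ≡⟨ cong (_% 2) (trans (cong suc (+-suc m n)) (+-comm 2 (m + n))) ⟩
  (m + n + 2) % 2     ≡⟨ [m+n]%n≡m%n (m + n) 2 ⟩
  (m + n) % 2         ≡⟨ [m+n]%2≡∣m-n∣%2 m n ⟩
  ∣ m - n ∣ % 2       ∎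
  where open ≡-Reasoning

m≤x∧n≤y∧x+y≡m+n⇒x≡m : ∀ {m n x y} → m ≤ x → n ≤ y → x + y ≡ m + n → x ≡ m
m≤x∧n≤y∧x+y≡m+n⇒x≡m {m} {n} {x} {y} m≤x n≤y eq =
  ≤-antisym (+-cancelʳ-≤ n x m (≤-trans (+-monoʳ-≤ x n≤y) (≤-reflexive eq))) m≤x

record InParityRange (a b k : ℕ) : Set where
  constructor inRange
  field
    lower  : a ≤ k
    upper  : k ≤ b
    parity : k % 2 ≡ a % 2

-- k = kl + kr − 2c with c ≤ kl, kr: c twins of each child are matched across the node.
record PairOff (kl kr k : ℕ) : Set where
  constructor pairOff
  field
    x y c : ℕ
    left  : kl ≡ x + c
    right : kr ≡ y + c
    total : k ≡ x + y

PairOff-comm : ∀ {kl kr k} → PairOff kl kr k → PairOff kr kl k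
PairOff-comm (pairOff x y c kl≡ kr≡ k≡) = pairOff y x c kr≡ kl≡ (trans k≡ (+-comm x y))

PairOff-parity : ∀ {kl kr k} → PairOff kl kr k → (kl + kr) % 2 ≡ k % 2
PairOff-parity (pairOff x y c refl refl refl) = begin
  (x + c + (y + c)) % 2
    ≡⟨ cong (_% 2) (solve 3 (λ x y c → x :+ c :+ (y :+ c) := x :+ y :+ c :* con 2) refl x y c) ⟩
  (x + y + c * 2) % 2   ≡⟨ [m+kn]%n≡m%n (x + y) c 2 ⟩
  (x + y) % 2           ∎
  where open ≡-Reasoning

-- The twin counts at which γ̂ of a ⊗-node is minimal, given the children's ranges of minimisers.
Attainable : (al bl ar br k : ℕ) → Set
Attainable al bl ar br k =
  ∃₂ λ kl kr → InParityRange al bl kl × InParityRange ar br kr × PairOff kl kr k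

Least : (ℕ → Set) → ℕ → Set
Least P n = P n × (∀ {k} → k < n → ¬ P k)

module _ {al bl ar br : ℕ} where

  Attainable-comm : ∀ {k} → Attainable al bl ar br k → Attainable ar br al bl k
  Attainable-comm (kl , kr , inˡ , inʳ , p) = kr , kl , inʳ , inˡ , PairOff-comm p

  attainable-parity : ∀ {k} → Attainable al bl ar br k → k % 2 ≡ ∣ al - ar ∣ % 2
  attainable-parity {k} (kl , kr , inRange _ _ parˡ , inRange _ _ parʳ , p) = begin
    k % 2                 ≡⟨ PairOff-parity p ⟨
    (kl + kr) % 2         ≡⟨ %-distribˡ-+ kl kr 2 ⟩
    (kl % 2 + kr % 2) % 2 ≡⟨ cong₂ (λ u w → (u + w) % 2) parˡ parʳ ⟩
    (al % 2 + ar % 2) % 2 ≡⟨ %-distribˡ-+ al ar 2 ⟨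
    (al + ar) % 2         ≡⟨ [m+n]%2≡∣m-n∣%2 al ar ⟩
    ∣ al - ar ∣ % 2       ∎
    where open ≡-Reasoning

  attainable-≥ : ∀ {k} → Attainable al bl ar br k → al ∸ br ≤ k
  attainable-≥ (_ , _ , inRange al≤kl _ _ , inRange _ kr≤br _ , pairOff x y c refl refl refl) =
    ≤-trans (m≤n+o⇒m∸n≤o al br al≤br+x) (m≤m+n x y)
    where
    al≤br+x : al ≤ br + x
    al≤br+x = begin
      al     ≤⟨ al≤kl ⟩
      x + c  ≤⟨ +-monoʳ-≤ x (≤-trans (m≤n+m c y) kr≤br) ⟩
      x + br ≡⟨ +-comm x br ⟩
      br + x ∎
      where open ≤-Reasoning

  attainable-∣al-ar∣%2 : al ≤ ar → ar ≤ bl → ar ≤ br → Attainable al bl ar br (∣ al - ar ∣ % 2)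
  attainable-∣al-ar∣%2 al≤ar ar≤bl ar≤br =
    kl , ar , inRange (m≤m+n al (q * 2)) (≤-trans kl≤ar ar≤bl) ([m+kn]%n≡m%n al q 2) ,
    inRange ≤-refl ar≤br refl ,
    pairOff 0 (d % 2) kl refl ar≡ (cong (_% 2) (m≤n⇒∣m-n∣≡n∸m al≤ar))
    where
    d q kl : ℕ
    d  = ar ∸ al
    q  = d / 2
    kl = al + q * 2
    ar≡ : ar ≡ d % 2 + kl
    ar≡ = begin
      ar                   ≡⟨ m+[n∸m]≡n al≤ar ⟨
      al + d               ≡⟨ cong (al +_) (m≡m%n+[m/n]*n d 2) ⟩
      al + (d % 2 + q * 2) ≡⟨ solve 3 (λ a r s → a :+ (r :+ s) := r :+ (a :+ s)) refl al (d % 2) (q * 2) ⟩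
      d % 2 + kl           ∎
      where open ≡-Reasoning
    kl≤ar : kl ≤ ar
    kl≤ar = subst (kl ≤_) (sym ar≡) (m≤n+m kl (d % 2))

module _ {al bl ar br : ℕ} (blˡ : InParityRange al bl bl) (brʳ : InParityRange ar br br) where
  open InParityRange

  least-attainable-beyond : br < al → Least (Attainable al bl ar br) (al ∸ br)
  least-attainable-beyond br<al =
    (al , br , inRange ≤-refl (lower blˡ) refl , brʳ ,
     pairOff (al ∸ br) 0 br (sym (m∸n+n≡m (<⇒≤ br<al))) refl (sym (+-identityʳ _))) ,
    λ k<al∸br att → <⇒≱ k<al∸br (attainable-≥ att)

  least-attainable-overlapping : al ≤ br → ar ≤ bl → Least (Attainable al bl ar br) (∣ al - ar ∣ % 2)
  least-attainable-overlapping al≤br ar≤bl = attain (≤-total al ar) , below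
    where
    attain : al ≤ ar ⊎ ar ≤ al → Attainable al bl ar br (∣ al - ar ∣ % 2)
    attain (inj₁ al≤ar) = attainable-∣al-ar∣%2 al≤ar ar≤bl (lower brʳ)
    attain (inj₂ ar≤al) = subst (Attainable al bl ar br) (cong (_% 2) (∣-∣-comm ar al))
                                (Attainable-comm (attainable-∣al-ar∣%2 ar≤al al≤br (lower blˡ)))
    below : ∀ {k} → k < ∣ al - ar ∣ % 2 → ¬ Attainable al bl ar br k
    below {k} k<A att = <⇒≱ k<A (subst (_≤ k) (attainable-parity att) (m%n≤m k 2))

least-attainable-comm : ∀ {al bl ar br n} → Least (Attainable ar br al bl) n → Least (Attainable al bl ar br) n
least-attainable-comm (att , below) = Attainable-comm att , λ k<n → below k<n ∘ Attainable-comm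

-- Finite subsets

private variable m n : ℕ

x∉p⇒∣p∪⁅x⁆∣≡1+∣p∣ : ∀ {x : Fin n} {p} → x ∉ p → ∣ p ∪ ⁅ x ⁆ ∣ ≡ suc ∣ p ∣
x∉p⇒∣p∪⁅x⁆∣≡1+∣p∣ {x = zero}  {inside  ∷ p} x∉p = contradiction here x∉p
x∉p⇒∣p∪⁅x⁆∣≡1+∣p∣ {x = zero}  {outside ∷ p} _   = cong (suc ∘ ∣_∣) (∪-identityʳ p)
x∉p⇒∣p∪⁅x⁆∣≡1+∣p∣ {x = suc x} {inside  ∷ p} x∉p = cong suc (x∉p⇒∣p∪⁅x⁆∣≡1+∣p∣ (x∉p ∘ there))
x∉p⇒∣p∪⁅x⁆∣≡1+∣p∣ {x = suc x} {outside ∷ p} x∉p = x∉p⇒∣p∪⁅x⁆∣≡1+∣p∣ (x∉p ∘ there)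

x∈p⇒∣p∣≡1+∣p─⁅x⁆∣ : ∀ {x : Fin n} {p} → x ∈ p → ∣ p ∣ ≡ suc ∣ p ─ ⁅ x ⁆ ∣
x∈p⇒∣p∣≡1+∣p─⁅x⁆∣ {p = inside ∷ p}  here       = cong (suc ∘ ∣_∣) (sym (p─⊥≡p p))
x∈p⇒∣p∣≡1+∣p─⁅x⁆∣ {p = inside ∷ p}  (there x∈p) = cong suc (x∈p⇒∣p∣≡1+∣p─⁅x⁆∣ x∈p)
x∈p⇒∣p∣≡1+∣p─⁅x⁆∣ {p = outside ∷ p} (there x∈p) = x∈p⇒∣p∣≡1+∣p─⁅x⁆∣ x∈p

∣p∣>0⇒Nonempty : ∀ {p : Subset n} → 0 < ∣ p ∣ → Nonempty p
∣p∣>0⇒Nonempty {p = inside  ∷ p} _   = zero , here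
∣p∣>0⇒Nonempty {p = outside ∷ p} 0<∣p∣ with ∣p∣>0⇒Nonempty 0<∣p∣
... | x , x∈p = suc x , there x∈p

x∉p─⁅x⁆ : ∀ (p : Subset n) x → x ∉ p ─ ⁅ x ⁆
x∉p─⁅x⁆ (_ ∷ p) zero    ()
x∉p─⁅x⁆ (_ ∷ p) (suc x) (there x∈p─⁅x⁆) = x∉p─⁅x⁆ p x x∈p─⁅x⁆

x∈p─⁅y⁆⇒x≢y : ∀ {p : Subset n} {x y} → x ∈ p ─ ⁅ y ⁆ → x ≢ y
x∈p─⁅y⁆⇒x≢y {p = p} x∈p─⁅x⁆ refl = x∉p─⁅x⁆ p _ x∈p─⁅x⁆

∪-lub : ∀ {p q r : Subset n} → p ⊆ r → q ⊆ r → p ∪ q ⊆ r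
∪-lub {p = p} {q} p⊆r q⊆r x∈p∪q = [ p⊆r , q⊆r ]′ (x∈p∪q⁻ p q x∈p∪q)

x∈p⇒⁅x⁆⊆p : ∀ {p : Subset n} {x} → x ∈ p → ⁅ x ⁆ ⊆ p
x∈p⇒⁅x⁆⊆p {x = x} x∈p y∈⁅x⁆ = subst (_∈ _) (sym (x∈⁅y⁆⇒x≡y x y∈⁅x⁆)) x∈p

y∉p∧y≢x⇒y∉p∪⁅x⁆ : ∀ {p : Subset n} {x y} → y ∉ p → y ≢ x → y ∉ p ∪ ⁅ x ⁆
y∉p∧y≢x⇒y∉p∪⁅x⁆ {p = p} {x} y∉p y≢x y∈ = [ y∉p , y≢x ∘ x∈⁅y⁆⇒x≡y x ]′ (x∈p∪q⁻ p _ y∈)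

p⊂p∪⁅x⁆ : ∀ {p : Subset n} {x} → x ∉ p → p ⊂ p ∪ ⁅ x ⁆
p⊂p∪⁅x⁆ {p = p} {x} x∉p = p⊆p∪q _ , x , q⊆p∪q p _ (x∈⁅x⁆ x) , x∉p

⊈⇒∃ : ∀ {p q : Subset n} → ¬ (p ⊆ q) → ∃ λ x → x ∈ p × x ∉ q
⊈⇒∃ {p = p} {q} p⊈q with any? (λ x → x ∈? p ×-dec ¬? (x ∈? q))
... | yes witness = witness
... | no none     =
  contradiction (λ {x} x∈p → decidable-stable (x ∈? q) (λ x∉q → none (x , x∈p , x∉q))) p⊈q

-- Subsets of a disjoint union

data Split (m n : ℕ) : Fin (m + n) → Set where
  inl : (a : Fin m) → Split m n (a ↑ˡ n)
  inr : (b : Fin n) → Split m n (m ↑ʳ b)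

split : ∀ m {n} (x : Fin (m + n)) → Split m n x
split zero    x       = inr x
split (suc m) zero    = inl zero
split (suc m) (suc x) with split m x
... | inl a = inl (suc a)
... | inr b = inr b

↑ˡ≢↑ʳ : ∀ {m n} (a : Fin m) (b : Fin n) → a ↑ˡ n ≢ m ↑ʳ b
↑ˡ≢↑ʳ zero    b ()
↑ˡ≢↑ʳ (suc a) b eq = ↑ˡ≢↑ʳ a b (suc-injective eq)

∣p++q∣≡∣p∣+∣q∣ : ∀ (p : Subset m) (q : Subset n) → ∣ p ++ q ∣ ≡ ∣ p ∣ + ∣ q ∣
∣p++q∣≡∣p∣+∣q∣ []            q = refl
∣p++q∣≡∣p∣+∣q∣ (inside  ∷ p) q = cong suc (∣p++q∣≡∣p∣+∣q∣ p q)
∣p++q∣≡∣p∣+∣q∣ (outside ∷ p) q = ∣p++q∣≡∣p∣+∣q∣ p q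

∈-++⁺ˡ : ∀ {p : Subset m} {q : Subset n} {a} → a ∈ p → a ↑ˡ n ∈ p ++ q
∈-++⁺ˡ here        = here
∈-++⁺ˡ (there a∈p) = there (∈-++⁺ˡ a∈p)

∈-++⁻ˡ : ∀ (p : Subset m) {q : Subset n} {a} → a ↑ˡ n ∈ p ++ q → a ∈ p
∈-++⁻ˡ (_ ∷ p) {a = zero}  here      = here
∈-++⁻ˡ (_ ∷ p) {a = suc a} (there h) = there (∈-++⁻ˡ p h)

∈-++⁺ʳ : ∀ (p : Subset m) {q : Subset n} {b} → b ∈ q → m ↑ʳ b ∈ p ++ q
∈-++⁺ʳ []      b∈q = b∈q
∈-++⁺ʳ (_ ∷ p) b∈q = there (∈-++⁺ʳ p b∈q)

∈-++⁻ʳ : ∀ (p : Subset m) {q : Subset n} {b} → m ↑ʳ b ∈ p ++ q → b ∈ q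
∈-++⁻ʳ []      h         = h
∈-++⁻ʳ (_ ∷ p) (there h) = ∈-++⁻ʳ p h

++-∪-⁅↑ˡ⁆ : ∀ (p : Subset m) (q : Subset n) a → (p ++ q) ∪ ⁅ a ↑ˡ n ⁆ ≡ (p ∪ ⁅ a ⁆) ++ q
++-∪-⁅↑ˡ⁆ (s ∷ p) q zero    =
  cong (_ ∷_) (trans (∪-identityʳ (p ++ q)) (cong (_++ q) (sym (∪-identityʳ p))))
++-∪-⁅↑ˡ⁆ (s ∷ p) q (suc a) = cong (_ ∷_) (++-∪-⁅↑ˡ⁆ p q a)

++-∪-⁅↑ʳ⁆ : ∀ (p : Subset m) (q : Subset n) b → (p ++ q) ∪ ⁅ m ↑ʳ b ⁆ ≡ p ++ (q ∪ ⁅ b ⁆)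
++-∪-⁅↑ʳ⁆ []      q b = refl
++-∪-⁅↑ʳ⁆ (s ∷ p) q b = cong₂ _∷_ (∨-identityʳ s) (++-∪-⁅↑ʳ⁆ p q b)

++-─-⁅↑ˡ⁆ : ∀ (p : Subset m) (q : Subset n) a → (p ++ q) ─ ⁅ a ↑ˡ n ⁆ ≡ (p ─ ⁅ a ⁆) ++ q
++-─-⁅↑ˡ⁆ (s ∷ p) q zero    =
  cong (outside ∷_) (trans (p─⊥≡p (p ++ q)) (cong (_++ q) (sym (p─⊥≡p p))))
++-─-⁅↑ˡ⁆ (s ∷ p) q (suc a) = cong (s ∷_) (++-─-⁅↑ˡ⁆ p q a)

++-─-⁅↑ʳ⁆ : ∀ (p : Subset m) (q : Subset n) b → (p ++ q) ─ ⁅ m ↑ʳ b ⁆ ≡ p ++ (q ─ ⁅ b ⁆)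
++-─-⁅↑ʳ⁆ []      q b = refl
++-─-⁅↑ʳ⁆ (s ∷ p) q b = cong (s ∷_) (++-─-⁅↑ʳ⁆ p q b)

++-∪-⁅↑ˡ⁆-⁅↑ʳ⁆ : ∀ (p : Subset m) (q : Subset n) a b →
                 ((p ++ q) ∪ ⁅ a ↑ˡ n ⁆) ∪ ⁅ m ↑ʳ b ⁆ ≡ (p ∪ ⁅ a ⁆) ++ (q ∪ ⁅ b ⁆)
++-∪-⁅↑ˡ⁆-⁅↑ʳ⁆ p q a b =
  trans (cong (_∪ ⁅ _ ↑ʳ b ⁆) (++-∪-⁅↑ˡ⁆ p q a)) (++-∪-⁅↑ʳ⁆ (p ∪ ⁅ a ⁆) q b)

++-─-⁅↑ˡ⁆-⁅↑ʳ⁆ : ∀ (p : Subset m) (q : Subset n) a b →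
                 (p ++ q) ─ ⁅ a ↑ˡ n ⁆ ─ ⁅ m ↑ʳ b ⁆ ≡ (p ─ ⁅ a ⁆) ++ (q ─ ⁅ b ⁆)
++-─-⁅↑ˡ⁆-⁅↑ʳ⁆ p q a b =
  trans (cong (_─ ⁅ _ ↑ʳ b ⁆) (++-─-⁅↑ˡ⁆ p q a)) (++-─-⁅↑ʳ⁆ (p ─ ⁅ a ⁆) q b)

++-⊆ : ∀ {p p′ : Subset m} {q q′ : Subset n} → p ⊆ p′ → q ⊆ q′ → p ++ q ⊆ p′ ++ q′
++-⊆ {m} {p = p} {p′} p⊆p′ q⊆q′ {x} x∈ with split m x
... | inl a = ∈-++⁺ˡ (p⊆p′ (∈-++⁻ˡ p x∈))
... | inr b = ∈-++⁺ʳ p′ (q⊆q′ (∈-++⁻ʳ p x∈))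

++-⊆⁻ˡ : ∀ {p p′ : Subset m} {q q′ : Subset n} → p ++ q ⊆ p′ ++ q′ → p ⊆ p′
++-⊆⁻ˡ {p′ = p′} ⊆ = ∈-++⁻ˡ p′ ∘ ⊆ ∘ ∈-++⁺ˡ

++-⊆⁻ʳ : ∀ {p p′ : Subset m} {q q′ : Subset n} → p ++ q ⊆ p′ ++ q′ → q ⊆ q′
++-⊆⁻ʳ {p = p} {p′} ⊆ = ∈-++⁻ʳ p′ ∘ ⊆ ∘ ∈-++⁺ʳ p

-- Perfect matchings

Partner : (t : Tree) (S X : Subset (size t)) → (Fin (size t) → Fin (size t)) →
          Fin (size t) → Fin (size t) → Set
Partner t S X M x w = w ∈ S × w ∉ X × w ≢ x × Adj t x w × M w ≡ x

-- HasPerfectMatching t S X is definitionally Σ M (IsPerfectMatching t S X M).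
IsPerfectMatching : (t : Tree) (S X : Subset (size t)) → (Fin (size t) → Fin (size t)) → Set
IsPerfectMatching t S X M = ∀ x → x ∈ S → x ∉ X → Partner t S X M x (M x)

JoinAdj-sym : ∀ {m n} {A : Fin m → Fin m → Set} {B : Fin n → Fin n → Set} {C : Fin m → Fin n → Set} →
  (∀ {a a′} → A a a′ → A a′ a) → (∀ {b b′} → B b b′ → B b′ b) →
  ∀ u w → JoinAdj A B C u w → JoinAdj A B C w u
JoinAdj-sym symA symB (inj₁ a) (inj₁ a′) = symA
JoinAdj-sym symA symB (inj₂ b) (inj₂ b′) = symB
JoinAdj-sym symA symB (inj₁ a) (inj₂ b)  = id
JoinAdj-sym symA symB (inj₂ b) (inj₁ a)  = id

Adj-sym : ∀ t {x y} → Adj t x y → Adj t y x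
Adj-sym leaf ()
Adj-sym (node _ l r) {x} {y} =
  JoinAdj-sym (Adj-sym l) (Adj-sym r) (Fin.splitAt (size l) x) (Fin.splitAt (size l) y)

module _ {n : ℕ} (x y : Fin n) (M : Fin n → Fin n) where

  pairUp : Fin n → Fin n
  pairUp z with z ≟ x | z ≟ y
  ... | yes _ | _     = y
  ... | no _  | yes _ = x
  ... | no _  | no _  = M z

  pairUp-x : pairUp x ≡ y
  pairUp-x with x ≟ x
  ... | yes _   = refl
  ... | no x≢x  = contradiction refl x≢x

  pairUp-y : x ≢ y → pairUp y ≡ x
  pairUp-y x≢y with y ≟ x | y ≟ y
  ... | yes y≡x | _       = contradiction (sym y≡x) x≢y
  ... | no _    | yes _   = refl
  ... | no _    | no y≢y  = contradiction refl y≢y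

  pairUp-other : ∀ {z} → z ≢ x → z ≢ y → pairUp z ≡ M z
  pairUp-other {z} z≢x z≢y with z ≟ x | z ≟ y
  ... | yes z≡x | _       = contradiction z≡x z≢x
  ... | no _    | yes z≡y = contradiction z≡y z≢y
  ... | no _    | no _    = refl

module _ {t : Tree} {S X : Subset (size t)} {M : Fin (size t) → Fin (size t)} where

  match-pair : ∀ {x y} → IsPerfectMatching t S X M → x ∈ S → y ∈ S → x ∈ X → y ∈ X → x ≢ y → Adj t x y →
               IsPerfectMatching t S (X ─ ⁅ x ⁆ ─ ⁅ y ⁆) (pairUp x y M)
  match-pair {x} {y} pm x∈S y∈S x∈X y∈X x≢y xy z z∈S z∉X′ = partner (z ≟ x) (z ≟ y)
    where
    partner : Dec (z ≡ x) → Dec (z ≡ y) → Partner t S (X ─ ⁅ x ⁆ ─ ⁅ y ⁆) (pairUp x y M) z (pairUp x y M z)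
    partner (yes refl) _ rewrite pairUp-x x y M =
      y∈S , (λ y∈ → x∈p─⁅y⁆⇒x≢y y∈ refl) , x≢y ∘ sym , xy , pairUp-y x y M x≢y
    partner (no _) (yes refl) rewrite pairUp-y x y M x≢y =
      x∈S , (λ x∈ → x∈p─⁅y⁆⇒x≢y (p─q⊆p _ _ x∈) refl) , x≢y , Adj-sym t xy , pairUp-x x y M
    partner (no z≢x) (no z≢y) rewrite pairUp-other x y M z≢x z≢y
      with pm z z∈S (λ z∈X → z∉X′ (x∈p∧x≢y⇒x∈p-y (x∈p∧x≢y⇒x∈p-y z∈X z≢x) z≢y))
    ... | Mz∈S , Mz∉X , Mz≢z , zMz , MMz≡z =
      Mz∈S , Mz∉X ∘ p─q⊆p _ _ ∘ p─q⊆p _ _ , Mz≢z , zMz ,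
      trans (pairUp-other x y M (λ Mz≡x → Mz∉X (subst (_∈ X) (sym Mz≡x) x∈X))
                                (λ Mz≡y → Mz∉X (subst (_∈ X) (sym Mz≡y) y∈X))) MMz≡z

  unmatch : ∀ {x} → IsPerfectMatching t S X M → x ∈ S → x ∉ X →
            IsPerfectMatching t S ((X ∪ ⁅ x ⁆) ∪ ⁅ M x ⁆) M
  unmatch {x} pm x∈S x∉X z z∈S z∉X′ with pm z z∈S (z∉X′ ∘ p⊆p∪q _ ∘ p⊆p∪q _)
  ... | Mz∈S , Mz∉X , Mz≢z , zMz , MMz≡z =
    Mz∈S , y∉p∧y≢x⇒y∉p∪⁅x⁆ (y∉p∧y≢x⇒y∉p∪⁅x⁆ Mz∉X Mz≢x) Mz≢Mx , Mz≢z , zMz , MMz≡z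
    where
    z≢x : z ≢ x
    z≢x refl = z∉X′ (p⊆p∪q _ (q⊆p∪q X _ (x∈⁅x⁆ z)))
    z≢Mx : z ≢ M x
    z≢Mx refl = z∉X′ (q⊆p∪q _ _ (x∈⁅x⁆ z))
    Mz≢x : M z ≢ x
    Mz≢x Mz≡x = z≢Mx (trans (sym MMz≡z) (cong M Mz≡x))
    MMx≡x : M (M x) ≡ x
    MMx≡x = proj₂ (proj₂ (proj₂ (proj₂ (pm x x∈S x∉X))))
    Mz≢Mx : M z ≢ M x
    Mz≢Mx Mz≡Mx = z≢x (trans (sym MMz≡z) (trans (cong M Mz≡Mx) MMx≡x))

-- Recursion on ⊃: each step moves a matched pair {x, M x} into X.
matching-parity : ∀ {t S X M} → X ⊆ S → IsPerfectMatching t S X M → ∃ λ j → ∣ S ∣ ≡ ∣ X ∣ + j * 2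
matching-parity {t} {S} {X} {M} = go (⊃-wellFounded X)
  where
  go : ∀ {X} → Acc _⊃_ X → X ⊆ S → IsPerfectMatching t S X M → ∃ λ j → ∣ S ∣ ≡ ∣ X ∣ + j * 2
  go {X} (acc larger) X⊆S pm with S ⊆? X
  ... | yes S⊆X = 0 , trans (cong ∣_∣ (⊆-antisym S⊆X X⊆S)) (sym (+-identityʳ _))
  ... | no S⊈X with ⊈⇒∃ S⊈X
  ...   | x , x∈S , x∉X with pm x x∈S x∉X
  ...     | Mx∈S , Mx∉X , Mx≢x , _ with go (larger X′⊃X) X′⊆S (unmatch {t = t} pm x∈S x∉X)
    where
    X′ = (X ∪ ⁅ x ⁆) ∪ ⁅ M x ⁆
    X′⊃X : X′ ⊃ X
    X′⊃X = ⊂-⊆-trans (p⊂p∪⁅x⁆ x∉X) (p⊆p∪q _)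
    X′⊆S : X′ ⊆ S
    X′⊆S = ∪-lub (∪-lub X⊆S (x∈p⇒⁅x⁆⊆p x∈S)) (x∈p⇒⁅x⁆⊆p Mx∈S)
  ... | j , ∣S∣≡ = suc j , (begin
    ∣ S ∣                                 ≡⟨ ∣S∣≡ ⟩
    ∣ (X ∪ ⁅ x ⁆) ∪ ⁅ M x ⁆ ∣ + j * 2
      ≡⟨ cong (_+ j * 2) (x∉p⇒∣p∪⁅x⁆∣≡1+∣p∣ (y∉p∧y≢x⇒y∉p∪⁅x⁆ Mx∉X Mx≢x)) ⟩
    suc ∣ X ∪ ⁅ x ⁆ ∣ + j * 2             ≡⟨ cong (λ s → suc s + j * 2) (x∉p⇒∣p∪⁅x⁆∣≡1+∣p∣ x∉X) ⟩
    suc (suc ∣ X ∣) + j * 2               ≡⟨ cong suc (+-suc ∣ X ∣ (j * 2)) ⟨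
    suc (∣ X ∣ + suc (j * 2))             ≡⟨ +-suc ∣ X ∣ (suc (j * 2)) ⟨
    ∣ X ∣ + suc j * 2                     ∎)
    where open ≡-Reasoning

-- Feasible sets

record Admissible (t : Tree) (S X : Subset (size t)) : Set where
  constructor admissible
  field
    X⊆S      : X ⊆ S
    X⊆TS     : X ⊆ TS t
    matching : HasPerfectMatching t S X

module _ {t : Tree} {S : Subset (size t)} where

  feasible : ∀ {X} → DominatesNonTwins t S → Admissible t S X → Feasible t ∣ X ∣ S
  feasible dom (admissible X⊆S X⊆TS pm) = dom , _ , X⊆S , X⊆TS , refl , pm

  feasible-≤ : ∀ {k} → Feasible t k S → k ≤ ∣ TS t ∣
  feasible-≤ (_ , _ , _ , X⊆TS , refl , _) = p⊆q⇒∣p∣≤∣q∣ X⊆TS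

  feasible-parity : ∀ {k} → Feasible t k S → ∣ S ∣ % 2 ≡ k % 2
  feasible-parity (_ , X , X⊆S , _ , refl , _ , pm) =
    let j , ∣S∣≡ = matching-parity {t = t} X⊆S pm
    in  trans (cong (_% 2) ∣S∣≡) ([m+kn]%n≡m%n ∣ X ∣ j 2)

module Join (lab : Label) (l r : Tree) where

  private
    N K : ℕ
    N = size l
    K = size r
    v : Tree
    v = node lab l r
    JA : Fin N Sum.⊎ Fin K → Fin N Sum.⊎ Fin K → Set
    JA = JoinAdj (Adj l) (Adj r) (Cross lab l r)

  Adj-↑ˡ : ∀ a a′ → Adj v (a ↑ˡ K) (a′ ↑ˡ K) ≡ Adj l a a′
  Adj-↑ˡ a a′ = cong₂ JA (splitAt-↑ˡ N a K) (splitAt-↑ˡ N a′ K)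

  Adj-↑ʳ : ∀ b b′ → Adj v (N ↑ʳ b) (N ↑ʳ b′) ≡ Adj r b b′
  Adj-↑ʳ b b′ = cong₂ JA (splitAt-↑ʳ N K b) (splitAt-↑ʳ N K b′)

  Adj-↑ˡ↑ʳ : ∀ a b → Adj v (a ↑ˡ K) (N ↑ʳ b) ≡ Cross lab l r a b
  Adj-↑ˡ↑ʳ a b = cong₂ JA (splitAt-↑ˡ N a K) (splitAt-↑ʳ N K b)

  joinMatching : (Fin N → Fin N) → (Fin K → Fin K) → Fin (N + K) → Fin (N + K)
  joinMatching Ml Mr = Fin.join N K ∘ Sum.map Ml Mr ∘ Fin.splitAt N

  module _ {Sl Xl : Subset N} {Sr Xr : Subset K} where

    matching-++ : ∀ {Ml Mr} → IsPerfectMatching l Sl Xl Ml → IsPerfectMatching r Sr Xr Mr →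
                  IsPerfectMatching v (Sl ++ Sr) (Xl ++ Xr) (joinMatching Ml Mr)
    matching-++ {Ml} {Mr} pmˡ pmʳ x x∈S x∉X = partner (split N x) x∈S x∉X
      where
      M = joinMatching Ml Mr
      M-↑ˡ : ∀ a → M (a ↑ˡ K) ≡ Ml a ↑ˡ K
      M-↑ˡ a = cong (Fin.join N K ∘ Sum.map Ml Mr) (splitAt-↑ˡ N a K)
      M-↑ʳ : ∀ b → M (N ↑ʳ b) ≡ N ↑ʳ Mr b
      M-↑ʳ b = cong (Fin.join N K ∘ Sum.map Ml Mr) (splitAt-↑ʳ N K b)
      partner : ∀ {x} → Split N K x → x ∈ Sl ++ Sr → x ∉ Xl ++ Xr → Partner v (Sl ++ Sr) (Xl ++ Xr) M x (M x)
      partner (inl a) x∈S x∉X rewrite M-↑ˡ a with pmˡ a (∈-++⁻ˡ Sl x∈S) (x∉X ∘ ∈-++⁺ˡ)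
      ... | Ma∈ , Ma∉ , Ma≢a , aMa , MMa≡a =
        ∈-++⁺ˡ Ma∈ , Ma∉ ∘ ∈-++⁻ˡ Xl , Ma≢a ∘ ↑ˡ-injective K _ _ ,
        subst id (sym (Adj-↑ˡ a (Ml a))) aMa ,
        trans (M-↑ˡ (Ml a)) (cong (_↑ˡ K) MMa≡a)
      partner (inr b) x∈S x∉X rewrite M-↑ʳ b with pmʳ b (∈-++⁻ʳ Sl x∈S) (x∉X ∘ ∈-++⁺ʳ Xl)
      ... | Mb∈ , Mb∉ , Mb≢b , bMb , MMb≡b =
        ∈-++⁺ʳ Sl Mb∈ , Mb∉ ∘ ∈-++⁻ʳ Xl , Mb≢b ∘ ↑ʳ-injective N _ _ ,
        subst id (sym (Adj-↑ʳ b (Mr b))) bMb ,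
        trans (M-↑ʳ (Mr b)) (cong (N ↑ʳ_) MMb≡b)

    module _ {M : Fin (N + K) → Fin (N + K)} (pm : IsPerfectMatching v (Sl ++ Sr) (Xl ++ Xr) M) where

      restrictˡ : Fin N → Fin N
      restrictˡ a = [ id , const a ]′ (Fin.splitAt N (M (a ↑ˡ K)))

      restrictʳ : Fin K → Fin K
      restrictʳ b = [ const b , id ]′ (Fin.splitAt N (M (N ↑ʳ b)))

      matching-restrictˡ : (∀ {a} → a ∈ Sl → a ∉ Xl → ∃ λ a′ → M (a ↑ˡ K) ≡ a′ ↑ˡ K) →
                           IsPerfectMatching l Sl Xl restrictˡ
      matching-restrictˡ stays a a∈ a∉ with stays a∈ a∉ | pm (a ↑ˡ K) (∈-++⁺ˡ a∈) (a∉ ∘ ∈-++⁻ˡ Xl)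
      ... | a′ , Ma≡ | Ma∈ , Ma∉ , Ma≢ , aMa , MMa≡ =
        subst (Partner l Sl Xl restrictˡ a) (sym (restrict≡ Ma≡))
          (∈-++⁻ˡ Sl (subst (_∈ _) Ma≡ Ma∈) , Ma∉ ∘ subst (_∈ _) (sym Ma≡) ∘ ∈-++⁺ˡ ,
           Ma≢ ∘ trans Ma≡ ∘ cong (_↑ˡ K) , subst id (Adj-↑ˡ a a′) (subst (Adj v (a ↑ˡ K)) Ma≡ aMa) ,
           restrict≡ (trans (cong M (sym Ma≡)) MMa≡))
        where
        restrict≡ : ∀ {a a′} → M (a ↑ˡ K) ≡ a′ ↑ˡ K → restrictˡ a ≡ a′
        restrict≡ {a} {a′} eq =
          trans (cong ([ id , const a ]′ ∘ Fin.splitAt N) eq) (cong [ id , const a ]′ (splitAt-↑ˡ N a′ K))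

      matching-restrictʳ : (∀ {b} → b ∈ Sr → b ∉ Xr → ∃ λ b′ → M (N ↑ʳ b) ≡ N ↑ʳ b′) →
                           IsPerfectMatching r Sr Xr restrictʳ
      matching-restrictʳ stays b b∈ b∉ with stays b∈ b∉ | pm (N ↑ʳ b) (∈-++⁺ʳ Sl b∈) (b∉ ∘ ∈-++⁻ʳ Xl)
      ... | b′ , Mb≡ | Mb∈ , Mb∉ , Mb≢ , bMb , MMb≡ =
        subst (Partner r Sr Xr restrictʳ b) (sym (restrict≡ Mb≡))
          (∈-++⁻ʳ Sl (subst (_∈ _) Mb≡ Mb∈) , Mb∉ ∘ subst (_∈ _) (sym Mb≡) ∘ ∈-++⁺ʳ Xl ,
           Mb≢ ∘ trans Mb≡ ∘ cong (N ↑ʳ_) , subst id (Adj-↑ʳ b b′) (subst (Adj v (N ↑ʳ b)) Mb≡ bMb) ,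
           restrict≡ (trans (cong M (sym Mb≡)) MMb≡))
        where
        restrict≡ : ∀ {b b′} → M (N ↑ʳ b) ≡ N ↑ʳ b′ → restrictʳ b ≡ b′
        restrict≡ {b} {b′} eq =
          trans (cong ([ const b , id ]′ ∘ Fin.splitAt N) eq) (cong [ const b , id ]′ (splitAt-↑ʳ N K b′))

module ⊗-Node (l r : Tree) where

  open Join ⊗ l r

  private
    N K : ℕ
    N = size l
    K = size r
    v : Tree
    v = node ⊗ l r

  module _ {Sl : Subset N} {Sr : Subset K} where

    dominates-++ : DominatesNonTwins l Sl → DominatesNonTwins r Sr → DominatesNonTwins v (Sl ++ Sr)
    dominates-++ domˡ domʳ x x∉TS = dominated (split N x) x∉TS
      where
      dominated : ∀ {x} → Split N K x → x ∉ TS v → x ∈ Sl ++ Sr Sum.⊎ ∃ λ y → y ∈ Sl ++ Sr × Adj v x y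
      dominated (inl a) a∉TS with domˡ a (a∉TS ∘ ∈-++⁺ˡ)
      ... | inj₁ a∈ = inj₁ (∈-++⁺ˡ a∈)
      ... | inj₂ (a′ , a′∈ , aa′) = inj₂ (a′ ↑ˡ K , ∈-++⁺ˡ a′∈ , subst id (sym (Adj-↑ˡ a a′)) aa′)
      dominated (inr b) b∉TS with domʳ b (b∉TS ∘ ∈-++⁺ʳ (TS l))
      ... | inj₁ b∈ = inj₁ (∈-++⁺ʳ Sl b∈)
      ... | inj₂ (b′ , b′∈ , bb′) = inj₂ (N ↑ʳ b′ , ∈-++⁺ʳ Sl b′∈ , subst id (sym (Adj-↑ʳ b b′)) bb′)

    -- A non-twin has no neighbour in the other child.
    dominatesˡ : DominatesNonTwins v (Sl ++ Sr) → DominatesNonTwins l Sl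
    dominatesˡ dom a a∉TS with dom (a ↑ˡ K) (a∉TS ∘ ∈-++⁻ˡ (TS l))
    ... | inj₁ a∈ = inj₁ (∈-++⁻ˡ Sl a∈)
    ... | inj₂ (y , y∈ , ay) with split N y
    ...   | inl a′ = inj₂ (a′ , ∈-++⁻ˡ Sl y∈ , subst id (Adj-↑ˡ a a′) ay)
    ...   | inr b  = contradiction (proj₁ (subst id (Adj-↑ˡ↑ʳ a b) ay)) a∉TS

    dominatesʳ : DominatesNonTwins v (Sl ++ Sr) → DominatesNonTwins r Sr
    dominatesʳ dom b b∉TS with dom (N ↑ʳ b) (b∉TS ∘ ∈-++⁻ʳ (TS l))
    ... | inj₁ b∈ = inj₁ (∈-++⁻ʳ Sl b∈)
    ... | inj₂ (y , y∈ , by) with split N y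
    ...   | inr b′ = inj₂ (b′ , ∈-++⁻ʳ Sl y∈ , subst id (Adj-↑ʳ b b′) by)
    ...   | inl a  = contradiction (proj₂ (subst id (Adj-↑ˡ↑ʳ a b) (Adj-sym v by))) b∉TS

    match-across : ∀ {Xl : Subset N} {Xr : Subset K} {a b} → Admissible v (Sl ++ Sr) (Xl ++ Xr) →
                   a ∈ Xl → b ∈ Xr → Admissible v (Sl ++ Sr) ((Xl ─ ⁅ a ⁆) ++ (Xr ─ ⁅ b ⁆))
    match-across {Xl} {Xr} {a} {b} (admissible X⊆S X⊆TS (_ , pm)) a∈Xl b∈Xr =
      subst (Admissible v (Sl ++ Sr)) (++-─-⁅↑ˡ⁆-⁅↑ʳ⁆ Xl Xr a b)
        (admissible (X⊆S ∘ p─q⊆p _ _ ∘ p─q⊆p _ _) (X⊆TS ∘ p─q⊆p _ _ ∘ p─q⊆p _ _)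
                    (_ , match-pair {t = v} pm (X⊆S x∈X) (X⊆S y∈X) x∈X y∈X (↑ˡ≢↑ʳ a b) xy))
      where
      x∈X : a ↑ˡ K ∈ Xl ++ Xr
      x∈X = ∈-++⁺ˡ a∈Xl
      y∈X : N ↑ʳ b ∈ Xl ++ Xr
      y∈X = ∈-++⁺ʳ Xl b∈Xr
      xy : Adj v (a ↑ˡ K) (N ↑ʳ b)
      xy = subst id (sym (Adj-↑ˡ↑ʳ a b)) (∈-++⁻ˡ (TS l) (X⊆TS x∈X) , ∈-++⁻ʳ (TS l) (X⊆TS y∈X))

    pair-off : ∀ c {Xl : Subset N} {Xr : Subset K} → c ≤ ∣ Xl ∣ → c ≤ ∣ Xr ∣ → Admissible v (Sl ++ Sr) (Xl ++ Xr) →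
               ∃₂ λ (Xl′ : Subset N) (Xr′ : Subset K) →
                 Admissible v (Sl ++ Sr) (Xl′ ++ Xr′) × ∣ Xl ∣ ≡ ∣ Xl′ ∣ + c × ∣ Xr ∣ ≡ ∣ Xr′ ∣ + c
    pair-off zero {Xl} {Xr} _ _ adm = Xl , Xr , adm , sym (+-identityʳ _) , sym (+-identityʳ _)
    pair-off (suc c) {Xl} {Xr} 1+c≤∣Xl∣ 1+c≤∣Xr∣ adm
      with ∣p∣>0⇒Nonempty {p = Xl} (≤-trans (s≤s z≤n) 1+c≤∣Xl∣)
         | ∣p∣>0⇒Nonempty {p = Xr} (≤-trans (s≤s z≤n) 1+c≤∣Xr∣)
    ... | a , a∈Xl | b , b∈Xr
      with pair-off c {Xl ─ ⁅ a ⁆} {Xr ─ ⁅ b ⁆}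
                      (s≤s⁻¹ (subst (suc c ≤_) (∣Xl∣≡ a∈Xl) 1+c≤∣Xl∣))
                      (s≤s⁻¹ (subst (suc c ≤_) (∣Xr∣≡ b∈Xr) 1+c≤∣Xr∣))
                      (match-across adm a∈Xl b∈Xr)
      where
      ∣Xl∣≡ = x∈p⇒∣p∣≡1+∣p─⁅x⁆∣ {p = Xl}
      ∣Xr∣≡ = x∈p⇒∣p∣≡1+∣p─⁅x⁆∣ {p = Xr}
    ... | Xl′ , Xr′ , adm′ , ∣Xl─a∣≡ , ∣Xr─b∣≡ =
      Xl′ , Xr′ , adm′ ,
      one-more (x∈p⇒∣p∣≡1+∣p─⁅x⁆∣ {p = Xl} a∈Xl) ∣Xl─a∣≡ ,
      one-more (x∈p⇒∣p∣≡1+∣p─⁅x⁆∣ {p = Xr} b∈Xr) ∣Xr─b∣≡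
      where
      one-more : ∀ {n m k} → n ≡ suc m → m ≡ k + c → n ≡ k + suc c
      one-more {k = k} n≡ m≡ = trans n≡ (trans (cong suc m≡) (sym (+-suc k c)))

    module _ {M : Fin (N + K) → Fin (N + K)} where

      Crossing : Subset N → Fin N → Set
      Crossing Xl a = a ∈ Sl × a ∉ Xl × ∃ λ b → M (a ↑ˡ K) ≡ N ↑ʳ b

      crossing? : ∀ Xl → Decidable (Crossing Xl)
      crossing? Xl a = a ∈? Sl ×-dec ¬? (a ∈? Xl) ×-dec any? (λ b → M (a ↑ˡ K) ≟ N ↑ʳ b)

      unmatch-crossing : ∀ {Xl : Subset N} {Xr : Subset K} {a b} →
        Xl ++ Xr ⊆ Sl ++ Sr → Xl ++ Xr ⊆ TS v → IsPerfectMatching v (Sl ++ Sr) (Xl ++ Xr) M →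
        a ∈ Sl → a ∉ Xl → M (a ↑ˡ K) ≡ N ↑ʳ b →
        let X′ = (Xl ∪ ⁅ a ⁆) ++ (Xr ∪ ⁅ b ⁆) in
        b ∉ Xr × X′ ⊆ Sl ++ Sr × X′ ⊆ TS v × IsPerfectMatching v (Sl ++ Sr) X′ M
      unmatch-crossing {Xl} {Xr} {a} {b} X⊆S X⊆TS pm a∈ a∉ Ma≡ with pm (a ↑ˡ K) (∈-++⁺ˡ a∈) (a∉ ∘ ∈-++⁻ˡ Xl)
      ... | Ma∈ , Ma∉ , _ , aMa , _ =
        Ma∉ ∘ subst (_∈ _) (sym Ma≡) ∘ ∈-++⁺ʳ Xl ,
        subst (_⊆ _) X′≡
          (∪-lub (∪-lub X⊆S (x∈p⇒⁅x⁆⊆p (∈-++⁺ˡ a∈))) (x∈p⇒⁅x⁆⊆p (subst (_∈ _) Ma≡ Ma∈))) ,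
        subst (_⊆ _) X′≡
          (∪-lub (∪-lub X⊆TS (x∈p⇒⁅x⁆⊆p (∈-++⁺ˡ a∈TS))) (x∈p⇒⁅x⁆⊆p (∈-++⁺ʳ (TS l) b∈TS))) ,
        subst (λ X → IsPerfectMatching v (Sl ++ Sr) X M)
              (trans (cong (λ y → ((Xl ++ Xr) ∪ ⁅ a ↑ˡ K ⁆) ∪ ⁅ y ⁆) Ma≡) X′≡)
              (unmatch {t = v} pm (∈-++⁺ˡ a∈) (a∉ ∘ ∈-++⁻ˡ Xl))
        where
        X′≡ : ((Xl ++ Xr) ∪ ⁅ a ↑ˡ K ⁆) ∪ ⁅ N ↑ʳ b ⁆ ≡ (Xl ∪ ⁅ a ⁆) ++ (Xr ∪ ⁅ b ⁆)
        X′≡ = ++-∪-⁅↑ˡ⁆-⁅↑ʳ⁆ Xl Xr a b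
        a∈TS = proj₁ (subst id (Adj-↑ˡ↑ʳ a b) (subst (Adj v (a ↑ˡ K)) Ma≡ aMa))
        b∈TS = proj₂ (subst id (Adj-↑ˡ↑ʳ a b) (subst (Adj v (a ↑ˡ K)) Ma≡ aMa))

      stayˡ : ∀ {Xl} → ¬ ∃ (Crossing Xl) → ∀ {a} → a ∈ Sl → a ∉ Xl → ∃ λ a′ → M (a ↑ˡ K) ≡ a′ ↑ˡ K
      stayˡ none {a} a∈ a∉ with M (a ↑ˡ K) in Ma≡
      ... | y with split N y
      ...   | inl a′ = a′ , refl
      ...   | inr b  = contradiction (a , a∈ , a∉ , b , Ma≡) none

      stayʳ : ∀ {Xl Xr} → IsPerfectMatching v (Sl ++ Sr) (Xl ++ Xr) M → ¬ ∃ (Crossing Xl) →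
              ∀ {b} → b ∈ Sr → b ∉ Xr → ∃ λ b′ → M (N ↑ʳ b) ≡ N ↑ʳ b′
      stayʳ {Xl} pm none {b} b∈ b∉ with M (N ↑ʳ b) | pm (N ↑ʳ b) (∈-++⁺ʳ Sl b∈) (b∉ ∘ ∈-++⁻ʳ Xl)
      ... | y | y∈ , y∉ , _ , _ , My≡ with split N y
      ...   | inr b′ = b′ , refl
      ...   | inl a  = contradiction (a , ∈-++⁻ˡ Sl y∈ , y∉ ∘ ∈-++⁺ˡ , b , My≡) none

      -- Unmatch crossing pairs (their ends are twins) until none is left; then M splits.
      separate : ∀ {Xl : Subset N} {Xr : Subset K} → Acc _⊃_ Xl →
        Xl ++ Xr ⊆ Sl ++ Sr → Xl ++ Xr ⊆ TS v → IsPerfectMatching v (Sl ++ Sr) (Xl ++ Xr) M →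
        ∃ λ c → ∃₂ λ (Xl′ : Subset N) (Xr′ : Subset K) →
          Admissible l Sl Xl′ × Admissible r Sr Xr′ × ∣ Xl′ ∣ ≡ ∣ Xl ∣ + c × ∣ Xr′ ∣ ≡ ∣ Xr ∣ + c
      separate {Xl} {Xr} (acc larger) X⊆S X⊆TS pm with any? (crossing? Xl)
      ... | no none =
        0 , Xl , Xr ,
        admissible (++-⊆⁻ˡ X⊆S) (++-⊆⁻ˡ X⊆TS) (_ , matching-restrictˡ pm (stayˡ none)) ,
        admissible (++-⊆⁻ʳ X⊆S) (++-⊆⁻ʳ X⊆TS) (_ , matching-restrictʳ pm (stayʳ pm none)) ,
        sym (+-identityʳ _) , sym (+-identityʳ _)
      ... | yes (a , a∈ , a∉ , b , Ma≡) with unmatch-crossing X⊆S X⊆TS pm a∈ a∉ Ma≡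
      ...   | b∉ , X′⊆S , X′⊆TS , pm′ with separate (larger (p⊂p∪⁅x⁆ a∉)) X′⊆S X′⊆TS pm′
      ...     | c , Xl′ , Xr′ , admˡ , admʳ , ∣Xl′∣≡ , ∣Xr′∣≡ =
        suc c , Xl′ , Xr′ , admˡ , admʳ ,
        trans ∣Xl′∣≡ (trans (cong (_+ c) (x∉p⇒∣p∪⁅x⁆∣≡1+∣p∣ a∉)) (sym (+-suc ∣ Xl ∣ c))) ,
        trans ∣Xr′∣≡ (trans (cong (_+ c) (x∉p⇒∣p∪⁅x⁆∣≡1+∣p∣ b∉)) (sym (+-suc ∣ Xr ∣ c)))

    feasible-join : ∀ {kl kr k} → Feasible l kl Sl → Feasible r kr Sr → PairOff kl kr k → Feasible v k (Sl ++ Sr)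
    feasible-join (domˡ , Xl , Xl⊆S , Xl⊆TS , refl , _ , pmˡ) (domʳ , Xr , Xr⊆S , Xr⊆TS , refl , _ , pmʳ)
                  (pairOff x y c ∣Xl∣≡ ∣Xr∣≡ k≡)
      with pair-off c {Xl} {Xr} (subst (c ≤_) (sym ∣Xl∣≡) (m≤n+m c x))
                                (subst (c ≤_) (sym ∣Xr∣≡) (m≤n+m c y))
                      (admissible (++-⊆ Xl⊆S Xr⊆S) (++-⊆ Xl⊆TS Xr⊆TS) (_ , matching-++ pmˡ pmʳ))
    ... | Xl′ , Xr′ , admissible X⊆S X⊆TS pm , ∣Xl∣≡′ , ∣Xr∣≡′ =
      dominates-++ domˡ domʳ , Xl′ ++ Xr′ , X⊆S , X⊆TS , ∣X∣≡k , pm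
      where
      ∣X∣≡k : ∣ Xl′ ++ Xr′ ∣ ≡ _
      ∣X∣≡k = trans (∣p++q∣≡∣p∣+∣q∣ Xl′ Xr′)
                (trans (cong₂ _+_ (+-cancelʳ-≡ c _ _ (trans (sym ∣Xl∣≡′) ∣Xl∣≡))
                                  (+-cancelʳ-≡ c _ _ (trans (sym ∣Xr∣≡′) ∣Xr∣≡)))
                       (sym k≡))

    feasible-split : ∀ {k} → Feasible v k (Sl ++ Sr) →
                     ∃₂ λ kl kr → Feasible l kl Sl × Feasible r kr Sr × PairOff kl kr k
    feasible-split (dom , X , X⊆S , X⊆TS , refl , M , pm) with Vec.splitAt N X
    ... | Xl , Xr , refl with separate {M = M} (⊃-wellFounded Xl) X⊆S X⊆TS pm
    ... | c , Xl′ , Xr′ , admˡ , admʳ , ∣Xl′∣≡ , ∣Xr′∣≡ =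
      ∣ Xl′ ∣ , ∣ Xr′ ∣ , feasible (dominatesˡ dom) admˡ , feasible (dominatesʳ dom) admʳ ,
      pairOff ∣ Xl ∣ ∣ Xr ∣ c ∣Xl′∣≡ ∣Xr′∣≡ (∣p++q∣≡∣p∣+∣q∣ Xl Xr)

-- Minimisers under the staircase property

min-unique : ∀ {t m m′} → IsMinGamma t m → IsMinGamma t m′ → m ≡ m′
min-unique ((k , k≤ , γ) , least) ((k′ , k′≤ , γ′) , least′) =
  ≤-antisym (least k′ _ k′≤ γ′) (least′ k _ k≤ γ)

alpha-unique : ∀ {t a a′} → IsAlpha t a → IsAlpha t a′ → a ≡ a′
alpha-unique {t} {a} {a′} (_ , min , _ , γ , below) (_ , min′ , _ , γ′ , below′) = ≤-antisym
  (≮⇒≥ λ a′<a → below a′ a′<a (subst (IsGamma t a′) (min-unique {t} min′ min) γ′))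
  (≮⇒≥ λ a<a′ → below′ a a<a′ (subst (IsGamma t a) (min-unique {t} min min′) γ))

beta-unique : ∀ {t b b′} → IsBeta t b → IsBeta t b′ → b ≡ b′
beta-unique {t} {b} {b′} (_ , min , b≤ , γ , above) (_ , min′ , b′≤ , γ′ , above′) = ≤-antisym
  (≮⇒≥ λ b′<b → above′ b b′<b b≤ (subst (IsGamma t b) (min-unique {t} min min′) γ))
  (≮⇒≥ λ b<b′ → above b′ b<b′ b′≤ (subst (IsGamma t b′) (min-unique {t} min′ min) γ′))

gamma-parity : ∀ {t k g} → IsGamma t k g → g % 2 ≡ k % 2
gamma-parity {t} {k} ((_ , F , ∣S∣≡g) , _) = subst (λ s → s % 2 ≡ k % 2) ∣S∣≡g (feasible-parity {t} F)

stair-inRange : ∀ {m a b k} → InParityRange a b k → stair m a b k ≡ m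
stair-inRange {m} {a} {b} {k} (inRange a≤k k≤b parity) with k ≤ᵇ a | b ≤ᵇ k
... | true  | _    = trans (cong (m +_) (m≤n⇒m∸n≡0 a≤k)) (+-identityʳ m)
... | false | true = trans (cong (m +_) (m≤n⇒m∸n≡0 k≤b)) (+-identityʳ m)
... | false | false rewrite m%d≡n%d⇒[m∸n]%d≡0 k a 2 parity = refl

staircase-gamma : ∀ {t m a b} → Staircase t → IsMinGamma t m → IsAlpha t a → IsBeta t b →
                  ∀ k → k ≤ ∣ TS t ∣ → IsGamma t k (stair m a b k)
staircase-gamma {t} (_ , _ , _ , isMin′ , isα′ , isβ′ , γ) isMin isα isβ
  with refl ← min-unique {t} isMin′ isMin
     | refl ← alpha-unique {t} isα′ isα
     | refl ← beta-unique {t} isβ′ isβ = γ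

module Minimisers {t : Tree} (st : Staircase t) {a b : ℕ} (isα : IsAlpha t a) (isβ : IsBeta t b) where

  minimum : ℕ
  minimum = proj₁ isα

  private
    isMin : IsMinGamma t minimum
    isMin = proj₁ (proj₂ isα)

    γa : IsGamma t a minimum
    γa = proj₁ (proj₂ (proj₂ (proj₂ isα)))

    below-a : ∀ k → k < a → ¬ IsGamma t k minimum
    below-a = proj₂ (proj₂ (proj₂ (proj₂ isα)))

    b≤∣TS∣ : b ≤ ∣ TS t ∣
    b≤∣TS∣ = proj₁ (proj₂ (proj₂ isβ))

    above-b : ∀ k → b < k → k ≤ ∣ TS t ∣ → ¬ IsGamma t k (proj₁ isβ)
    above-b = proj₂ (proj₂ (proj₂ (proj₂ isβ)))

    minβ≡ : proj₁ isβ ≡ minimum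
    minβ≡ = min-unique {t} (proj₁ (proj₂ isβ)) isMin

    γ : ∀ k → k ≤ ∣ TS t ∣ → IsGamma t k (stair minimum a b k)
    γ = staircase-gamma {t} st isMin isα isβ

  minimum-≤ : ∀ {k S} → Feasible t k S → minimum ≤ ∣ S ∣
  minimum-≤ {k} F = ≤-trans (proj₂ isMin k _ k≤ (γ k k≤)) (proj₂ (γ k k≤) _ F)
    where k≤ = feasible-≤ {t = t} F

  isGamma-minimum : ∀ {k S} → Feasible t k S → ∣ S ∣ ≡ minimum → IsGamma t k minimum
  isGamma-minimum F ∣S∣≡ = (_ , F , ∣S∣≡) , λ _ → minimum-≤

  minimiser⇒inRange : ∀ {k} → IsGamma t k minimum → InParityRange a b k
  minimiser⇒inRange {k} γk = inRange
    (≮⇒≥ λ k<a → below-a k k<a γk)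
    (≮⇒≥ λ b<k → above-b k b<k (feasible-≤ {t = t} (proj₁ (proj₂ (proj₁ γk))))
                              (subst (IsGamma t k) (sym minβ≡) γk))
    (trans (sym (gamma-parity {t} γk)) (gamma-parity {t} γa))

  inRange⇒minimiser : ∀ {k} → InParityRange a b k → IsGamma t k minimum
  inRange⇒minimiser {k} range =
    subst (IsGamma t k) (stair-inRange range) (γ k (≤-trans (InParityRange.upper range) b≤∣TS∣))

  β-inRange : InParityRange a b b
  β-inRange = minimiser⇒inRange (subst (IsGamma t b) minβ≡ (proj₁ (proj₂ (proj₂ (proj₂ isβ)))))

module ⊗-Minimisers {l r : Tree} (stˡ : Staircase l) (stʳ : Staircase r) {al bl ar br : ℕ}
  (isαl : IsAlpha l al) (isβl : IsBeta l bl) (isαr : IsAlpha r ar) (isβr : IsBeta r br) where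

  module L = Minimisers {l} stˡ isαl isβl
  module R = Minimisers {r} stʳ isαr isβr
  open ⊗-Node l r

  private
    v : Tree
    v = node ⊗ l r

  minimum : ℕ
  minimum = L.minimum + R.minimum

  minimum-≤ : ∀ {k S} → Feasible v k S → minimum ≤ ∣ S ∣
  minimum-≤ {S = S} F with Vec.splitAt (size l) S
  ... | Sl , Sr , refl with feasible-split {Sl} {Sr} F
  ... | _ , _ , Fl , Fr , _ =
    subst (minimum ≤_) (sym (∣p++q∣≡∣p∣+∣q∣ Sl Sr)) (+-mono-≤ (L.minimum-≤ Fl) (R.minimum-≤ Fr))

  minimiser⇒attainable : ∀ {k} → IsGamma v k minimum → Attainable al bl ar br k
  minimiser⇒attainable ((S , F , ∣S∣≡) , _) with Vec.splitAt (size l) S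
  ... | Sl , Sr , refl with feasible-split {Sl} {Sr} F
  ... | kl , kr , Fl , Fr , p =
    kl , kr , L.minimiser⇒inRange (L.isGamma-minimum Fl ∣Sl∣≡) ,
    R.minimiser⇒inRange (R.isGamma-minimum Fr ∣Sr∣≡) , p
    where
    sum≡ : ∣ Sl ∣ + ∣ Sr ∣ ≡ L.minimum + R.minimum
    sum≡ = trans (sym (∣p++q∣≡∣p∣+∣q∣ Sl Sr)) ∣S∣≡
    ∣Sl∣≡ = m≤x∧n≤y∧x+y≡m+n⇒x≡m (L.minimum-≤ Fl) (R.minimum-≤ Fr) sum≡
    ∣Sr∣≡ = m≤x∧n≤y∧x+y≡m+n⇒x≡m (R.minimum-≤ Fr) (L.minimum-≤ Fl)
              (trans (+-comm ∣ Sr ∣ ∣ Sl ∣) (trans sum≡ (+-comm L.minimum R.minimum)))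

  attainable⇒minimiser : ∀ {k} → Attainable al bl ar br k → IsGamma v k minimum
  attainable⇒minimiser (_ , _ , rangeˡ , rangeʳ , p)
    with L.inRange⇒minimiser rangeˡ | R.inRange⇒minimiser rangeʳ
  ... | (Sl , Fl , ∣Sl∣≡) , _ | (Sr , Fr , ∣Sr∣≡) , _ =
    (Sl ++ Sr , feasible-join Fl Fr p , trans (∣p++q∣≡∣p∣+∣q∣ Sl Sr) (cong₂ _+_ ∣Sl∣≡ ∣Sr∣≡)) ,
    λ _ → minimum-≤

  isAlpha : ∀ {A} → Least (Attainable al bl ar br) A → IsAlpha v A
  isAlpha {A} (att , below) = minimum , isMin , A≤ , γA , λ k k<A γk → below k<A (minimiser⇒attainable γk)
    where
    γA : IsGamma v A minimum
    γA = attainable⇒minimiser att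
    A≤ : A ≤ ∣ TS v ∣
    A≤ = feasible-≤ {t = v} (proj₁ (proj₂ (proj₁ γA)))
    isMin : IsMinGamma v minimum
    isMin = (A , A≤ , γA) , λ { k g _ ((S , F , ∣S∣≡g) , _) → subst (minimum ≤_) ∣S∣≡g (minimum-≤ F) }

lemma8 : (l r : Tree) → Staircase l → Staircase r →
    (al bl ar br : ℕ) → IsAlpha l al → IsBeta l bl → IsAlpha r ar → IsBeta r br →
    ((br < al → IsAlpha (node ⊗ l r) (al ∸ br)) ×
     (bl < ar → IsAlpha (node ⊗ l r) (ar ∸ bl)) ×
     (al ≤ br → ar ≤ bl → IsAlpha (node ⊗ l r) (∣ al - ar ∣ % 2)))
lemma8 l r stˡ stʳ al bl ar br isαl isβl isαr isβr =
  (λ br<al → isAlpha {al ∸ br} (least-attainable-beyond L.β-inRange R.β-inRange br<al)) ,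
  (λ bl<ar → isAlpha {ar ∸ bl}
                (least-attainable-comm (least-attainable-beyond R.β-inRange L.β-inRange bl<ar))) ,
  (λ al≤br ar≤bl → isAlpha {∣ al - ar ∣ % 2}
                      (least-attainable-overlapping L.β-inRange R.β-inRange al≤br ar≤bl))
  where open ⊗-Minimisers {l} {r} stˡ stʳ isαl isβl isαr isβr
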